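{- Every $n$-step staircase $\mathcal{C}\subseteq\mathbb{Z}^3$ has convex dimension at most $3$.
   Context: Points of $\mathbb{Z}^3$ are regarded as multisets over $\{x,y,z\}$; $A\subset B$ means coordinatewise $\le$ and $A\ne B$; $A\cup B$ is the coordinatewise maximum. A digital cuboid is a set $C=\{(x,y,z)\in\mathbb{Z}^3: x_{\min}\le x\le x_{\max},\ y_{\min}\le y\le y_{\max},\ z_{\min}\le z\le z_{\max}\}$ with $|C|>1$. A sequence of cuboids $C_1,\dots,C_n$ (with parameters $x^i_{\min},x^i_{\max}$, etc.) is regular if (a) $x^1_{\min}=y^1_{\min}=z^1_{\min}=0$; (b) for each $1\le i\le n-1$: $x^i_{\min}\le x^{i+1}_{\min}$, $y^i_{\min}\le y^{i+1}_{\min}$, $z^i_{\min}\le z^{i+1}_{\min}$, at least one strict; (c) for each $1\le i\le n-1$: $x^{i+1}_{\min}\le x^i_{\max}$, $y^{i+1}_{\min}\le y^i_{\max}$, $z^{i+1}_{\min}\le z^i_{\max}$; (d) for each $1\le i\le n-1$: $x^i_{\max}\le x^{i+1}_{\max}$, $y^i_{\max}\le y^{i+1}_{\max}$, $z^i_{\max}\le z^{i+1}_{\max}$, at least one strict. The union $\mathcal{C}=C_1\cup\dots\cup C_n$ of a regular sequence is an $n$-step staircase. For a finite set $S\subseteq\mathbb{Z}^3$ with maximum element $X_{\max}$ (coordinatewise maximum of $S$, lying in $S$), a maximal chain is a sequence $(0,0,0)=X_0\subset X_1\subset\dots\subset X_k=X_{\max}$ of points of $S$ in which each $X_i$ is obtained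 from $X_{i-1}$ by adding $1$ to a single coordinate. The convex dimension of $S$ is the minimum number $m$ of maximal chains $\Gamma_1,\dots,\Gamma_m$ such that $S=\{A_1\cup\dots\cup A_m: A_j\in\Gamma_j\}$. -}

module Defs where

open import Data.Nat using (ℕ; zero; suc) renaming (_≤_ to _≤ℕ_)
open import Data.Integer using (ℤ; _≤_; _<_; _+_; _⊔_; +_)
open import Data.Fin using (Fin; inject₁) renaming (zero to fzero; suc to fsuc)
open import Data.List using (List; []; _∷_)
open import Data.List.Membership.Propositional using (_∈_)
open import Data.Product using (Σ; ∃; _×_; _,_)
open import Data.Sum using (_⊎_)
open import Data.Empty using (⊥)
open import Relation.Binary.PropositionalEquality using (_≡_; _≢_)
open import Function.Bundles using (_⇔_)

record Point : Set where
  constructor pt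
  field
    px py pz : ℤ
open Point public

origin : Point
origin = pt (+ 0) (+ 0) (+ 0)

_≼_ : Point → Point → Set
A ≼ B = (px A ≤ px B) × (py A ≤ py B) × (pz A ≤ pz B)

_∪_ : Point → Point → Point
A ∪ B = pt (px A ⊔ px B) (py A ⊔ py B) (pz A ⊔ pz B)

PSet : Set₁
PSet = Point → Set

record Cuboid : Set where
  constructor cuboid
  field
    xmin xmax ymin ymax zmin zmax : ℤ
open Cuboid public

_∈C_ : Point → Cuboid → Set
p ∈C C = (xmin C ≤ px p × px p ≤ xmax C)
       × (ymin C ≤ py p × py p ≤ ymax C)
       × (zmin C ≤ pz p × pz p ≤ zmax C)

MoreThanOnePoint : Cuboid → Set
MoreThanOnePoint C = Σ Point λ p → Σ Point λ q → p ∈C C × q ∈C C × p ≢ q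

LeOneStrict : ℤ → ℤ → ℤ → ℤ → ℤ → ℤ → Set
LeOneStrict a a' b b' c c' =
  (a ≤ a' × b ≤ b' × c ≤ c') × (a < a' ⊎ b < b' ⊎ c < c')

-- regularity of C₁,…,C_n  (n = suc m, consecutive pairs indexed by Fin m)
Regular : (m : ℕ) → (Fin (suc m) → Cuboid) → Set
Regular m C =
  (∀ i → MoreThanOnePoint (C i))
  × (xmin (C fzero) ≡ + 0 × ymin (C fzero) ≡ + 0 × zmin (C fzero) ≡ + 0)
  × (∀ (i : Fin m) →
       let A = C (inject₁ i) ; B = C (fsuc i) in
       LeOneStrict (xmin A) (xmin B) (ymin A) (ymin B) (zmin A) (zmin B)
       × (xmin B ≤ xmax A × ymin B ≤ ymax A × zmin B ≤ zmax A)
       × LeOneStrict (xmax A) (xmax B) (ymax A) (ymax B) (zmax A) (zmax B))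

Staircase : (m : ℕ) → (Fin (suc m) → Cuboid) → PSet
Staircase m C p = ∃ λ i → p ∈C C i

UnitStep : Point → Point → Set
UnitStep p q =
    (q ≡ pt (px p + + 1) (py p) (pz p))
  ⊎ (q ≡ pt (px p) (py p + + 1) (pz p))
  ⊎ (q ≡ pt (px p) (py p) (pz p + + 1))

IsMax : PSet → Point → Set
IsMax S X = S X × (∀ p → S p → p ≼ X)

IsChainTo : PSet → List Point → Point → Set
IsChainTo S [] X = ⊥
IsChainTo S (p ∷ []) X = S p × p ≡ X
IsChainTo S (p ∷ q ∷ r) X = S p × UnitStep p q × IsChainTo S (q ∷ r) X

MaximalChain : PSet → List Point → Set
MaximalChain S Γ =
  Σ Point λ X → IsMax S X
    × (Σ (List Point) λ rest → Γ ≡ origin ∷ rest)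
    × IsChainTo S Γ X

bigUnion : (k : ℕ) → (Fin (suc k) → Point) → Point
bigUnion zero A = A fzero
bigUnion (suc k) A = A fzero ∪ bigUnion k (λ i → A (fsuc i))

GeneratedBy : PSet → (k : ℕ) → (Fin (suc k) → List Point) → Set
GeneratedBy S k Γ =
  ∀ p → S p ⇔ (Σ (Fin (suc k) → Point) λ A → (∀ j → A j ∈ Γ j) × p ≡ bigUnion k A)

ConvexDimAtMost : PSet → ℕ → Set
ConvexDimAtMost S d =
  Σ ℕ λ k → suc k ≤ℕ d ×
    Σ (Fin (suc k) → List Point) λ Γ →
      (∀ j → MaximalChain S (Γ j)) × GeneratedBy S k Γ

-- A staircase S is closed under ∪, so it is generated by three maximal chains
-- Γx, Γy, Γz as soon as every p ∈ S lies above a point of Γx with the same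
-- x-coordinate, above a point of Γy with the same y-coordinate and above a point
-- of Γz with the same z-coordinate: p is then the join of these three points.
-- Γx visits the cuboids in order; in Cᵢ it runs along the bottom edge
-- (y, z) = (yⁱmin, zⁱmin) from x = xⁱ⁻¹max up to x = xⁱmax, then climbs to the
-- bottom edge of Cᵢ₊₁. As the minimum corners increase, p lies above the point
-- with abscissa px p on the first of these edges that reaches px p.
-- Γy and Γz are Γx for the staircase with cyclically permuted coordinates.
module Submission where

open import Defs
open import Data.Nat using (ℕ; suc)
open import Data.Fin using (Fin)

open import Data.Nat using (zero; z≤n; s≤s) renaming (_≤_ to _≤ℕ_)
open import Data.Integer using (ℤ; +_; _+_; _-_; -_; _⊔_; ∣_∣; _≤_; +≤+)
open import Data.Integer.Properties
  using (≤-refl; ≤-trans; ≤-antisym; <⇒≤; ≰⇒>; _≤?_; +-identityʳ; +-assoc; +-comm;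
         +-inverseˡ; +-monoˡ-≤; i≤j⇒0≤j-i; 0≤i⇒+∣i∣≡i; i≤i+j; i≤i⊔j; i≤j⊔i; ⊔-lub; ⊔-comm)
open import Data.Fin using (inject₁) renaming (zero to fzero; suc to fsuc)
open import Data.List using (List; []; _∷_; _++_; replicate; map)
open import Data.List.Membership.Propositional using (_∈_)
open import Data.List.Membership.Propositional.Properties using (∈-++⁺ˡ; ∈-++⁺ʳ; ∈-++⁻; ∈-map⁺)
open import Data.List.Relation.Unary.Any using (here; there)
open import Data.Vec.Functional using (Vector) renaming ([] to []ᵛ; _∷_ to _∷ᵛ_)
open import Data.Product using (Σ; _×_; _,_; proj₁; proj₂)
open import Data.Sum using (_⊎_; inj₁; inj₂)
open import Relation.Nullary using (yes; no; contradiction)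
open import Relation.Binary.PropositionalEquality
open import Function using (_∘_)
open import Function.Bundles using (_⇔_; mk⇔; Equivalence)

pt-cong : ∀ {a a′ b b′ c c′} → a ≡ a′ → b ≡ b′ → c ≡ c′ → pt a b c ≡ pt a′ b′ c′
pt-cong refl refl refl = refl

≼-refl : ∀ {p} → p ≼ p
≼-refl = ≤-refl , ≤-refl , ≤-refl

≼-trans : ∀ {p q r} → p ≼ q → q ≼ r → p ≼ r
≼-trans (a , b , c) (a′ , b′ , c′) = ≤-trans a a′ , ≤-trans b b′ , ≤-trans c c′

≼-antisym : ∀ {p q} → p ≼ q → q ≼ p → p ≡ q
≼-antisym (a , b , c) (a′ , b′ , c′) = pt-cong (≤-antisym a a′) (≤-antisym b b′) (≤-antisym c c′)

∪-upperˡ : ∀ p q → p ≼ (p ∪ q)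
∪-upperˡ p q = i≤i⊔j _ _ , i≤i⊔j _ _ , i≤i⊔j _ _

∪-upperʳ : ∀ p q → q ≼ (p ∪ q)
∪-upperʳ p q = i≤j⊔i _ _ , i≤j⊔i _ _ , i≤j⊔i _ _

∪-lub : ∀ {p q r} → p ≼ r → q ≼ r → (p ∪ q) ≼ r
∪-lub (a , b , c) (a′ , b′ , c′) = ⊔-lub a a′ , ⊔-lub b b′ , ⊔-lub c c′

∪-comm : ∀ p q → p ∪ q ≡ q ∪ p
∪-comm p q = pt-cong (⊔-comm _ _) (⊔-comm _ _) (⊔-comm _ _)

join-of-witnesses : ∀ {p qx qy qz} → qx ≼ p → qy ≼ p → qz ≼ p →
                    px p ≤ px qx → py p ≤ py qy → pz p ≤ pz qz → p ≡ qx ∪ (qy ∪ qz)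
join-of-witnesses {qx = qx} {qy} {qz} qx≼p qy≼p qz≼p x≤ y≤ z≤ =
  ≼-antisym (≤-trans x≤ (i≤i⊔j (px qx) _) ,
             ≤-trans y≤ (≤-trans (i≤i⊔j (py qy) (py qz)) (i≤j⊔i (py qx) _)) ,
             ≤-trans z≤ (≤-trans (i≤j⊔i (pz qy) (pz qz)) (i≤j⊔i (pz qx) _)))
            (∪-lub qx≼p (∪-lub qy≼p qz≼p))

minCorner maxCorner : Cuboid → Point
minCorner B = pt (xmin B) (ymin B) (zmin B)
maxCorner B = pt (xmax B) (ymax B) (zmax B)

_∈□_ : Point → Cuboid → Set
p ∈□ B = minCorner B ≼ p × p ≼ maxCorner B

∈C⇒∈□ : ∀ {p B} → p ∈C B → p ∈□ B
∈C⇒∈□ ((a , a′) , (b , b′) , (c , c′)) = (a , b , c) , (a′ , b′ , c′)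

∈□⇒∈C : ∀ {p B} → p ∈□ B → p ∈C B
∈□⇒∈C ((a , b , c) , (a′ , b′ , c′)) = (a , a′) , (b , b′) , (c , c′)

∈□-convex : ∀ {p q r B} → p ∈□ B → r ∈□ B → p ≼ q → q ≼ r → q ∈□ B
∈□-convex (min≼p , _) (_ , r≼max) p≼q q≼r = ≼-trans min≼p p≼q , ≼-trans q≼r r≼max

maxCorner-∈□ : ∀ {B} → minCorner B ≼ maxCorner B → maxCorner B ∈□ B
maxCorner-∈□ nonempty = nonempty , ≼-refl

-- Lattice paths

data Dir : Set where
  dx dy dz : Dir

advance : Dir → ℤ → Point → Point
advance dx k p = pt (px p + k) (py p) (pz p)
advance dy k p = pt (px p) (py p + k) (pz p)
advance dz k p = pt (px p) (py p) (pz p + k)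

advance-zero : ∀ d p → advance d (+ 0) p ≡ p
advance-zero dx p = cong (λ a → pt a (py p) (pz p)) (+-identityʳ (px p))
advance-zero dy p = cong (λ b → pt (px p) b (pz p)) (+-identityʳ (py p))
advance-zero dz p = cong (λ c → pt (px p) (py p) c) (+-identityʳ (pz p))

advance-advance : ∀ d i j p → advance d j (advance d i p) ≡ advance d (i + j) p
advance-advance dx i j p = cong (λ a → pt a (py p) (pz p)) (+-assoc (px p) i j)
advance-advance dy i j p = cong (λ b → pt (px p) b (pz p)) (+-assoc (py p) i j)
advance-advance dz i j p = cong (λ c → pt (px p) (py p) c) (+-assoc (pz p) i j)

step : Dir → Point → Point
step d = advance d (+ 1)

step-unit : ∀ d p → UnitStep p (step d p)
step-unit dx p = inj₁ refl
step-unit dy p = inj₂ (inj₁ refl)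
step-unit dz p = inj₂ (inj₂ refl)

step-≼ : ∀ d p → p ≼ step d p
step-≼ dx p = i≤i+j _ (+ 1) , ≤-refl , ≤-refl
step-≼ dy p = ≤-refl , i≤i+j _ (+ 1) , ≤-refl
step-≼ dz p = ≤-refl , ≤-refl , i≤i+j _ (+ 1)

steps : Point → List Dir → List Point
steps p []       = []
steps p (d ∷ ds) = step d p ∷ steps (step d p) ds

walk : Point → List Dir → List Point
walk p ds = p ∷ steps p ds

endpoint : Point → List Dir → Point
endpoint p []       = p
endpoint p (d ∷ ds) = endpoint (step d p) ds

endpoint-∈-walk : ∀ p ds → endpoint p ds ∈ walk p ds
endpoint-∈-walk p []       = here refl
endpoint-∈-walk p (d ∷ ds) = there (endpoint-∈-walk (step d p) ds)

≼-endpoint : ∀ p ds → p ≼ endpoint p ds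
≼-endpoint p []       = ≼-refl
≼-endpoint p (d ∷ ds) = ≼-trans (step-≼ d p) (≼-endpoint (step d p) ds)

walk-between : ∀ {p q} ds → q ∈ walk p ds → p ≼ q × q ≼ endpoint p ds
walk-between {p} ds       (here refl) = ≼-refl , ≼-endpoint p ds
walk-between {p} (d ∷ ds) (there q∈)  =
  let p′≼q , q≼end = walk-between ds q∈ in ≼-trans (step-≼ d p) p′≼q , q≼end

walk-isChainTo : ∀ {S : PSet} p ds → (∀ {q} → q ∈ walk p ds → S q) →
                 IsChainTo S (walk p ds) (endpoint p ds)
walk-isChainTo p []       inS = inS (here refl) , refl
walk-isChainTo p (d ∷ ds) inS =
  inS (here refl) , step-unit d p , walk-isChainTo (step d p) ds (inS ∘ there)

walk-maximalChain : ∀ {S : PSet} p ds → (∀ {q} → q ∈ walk p ds → S q) →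
                    (∀ q → S q → q ≼ endpoint p ds) → p ≡ origin → MaximalChain S (walk p ds)
walk-maximalChain p ds inS upper p≡o =
  endpoint p ds , (inS (endpoint-∈-walk p ds) , upper) ,
  (steps p ds , cong (_∷ steps p ds) p≡o) , walk-isChainTo p ds inS

endpoint-++ : ∀ p ds es → endpoint p (ds ++ es) ≡ endpoint (endpoint p ds) es
endpoint-++ p []       es = refl
endpoint-++ p (d ∷ ds) es = endpoint-++ (step d p) ds es

steps-++ : ∀ p ds es → steps p (ds ++ es) ≡ steps p ds ++ steps (endpoint p ds) es
steps-++ p []       es = refl
steps-++ p (d ∷ ds) es = cong (step d p ∷_) (steps-++ (step d p) ds es)

∈-walk-++ˡ : ∀ {p q} ds es → q ∈ walk p ds → q ∈ walk p (ds ++ es)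
∈-walk-++ˡ ds es (here refl) = here refl
∈-walk-++ˡ {p} ds es (there q∈) rewrite steps-++ p ds es = there (∈-++⁺ˡ q∈)

∈-walk-++ʳ : ∀ {p q} ds es → q ∈ walk (endpoint p ds) es → q ∈ walk p (ds ++ es)
∈-walk-++ʳ {p} ds es (here refl) = ∈-walk-++ˡ ds es (endpoint-∈-walk p ds)
∈-walk-++ʳ {p} ds es (there q∈) rewrite steps-++ p ds es = there (∈-++⁺ʳ (steps p ds) q∈)

∈-walk-++⁻ : ∀ {p q} ds es → q ∈ walk p (ds ++ es) → q ∈ walk p ds ⊎ q ∈ walk (endpoint p ds) es
∈-walk-++⁻ ds es (here refl) = inj₁ (here refl)
∈-walk-++⁻ {p} ds es (there q∈) rewrite steps-++ p ds es with ∈-++⁻ (steps p ds) q∈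
... | inj₁ q∈ds = inj₁ (there q∈ds)
... | inj₂ q∈es = inj₂ (there q∈es)

endpoint-replicate : ∀ p k d → endpoint p (replicate k d) ≡ advance d (+ k) p
endpoint-replicate p zero    d = sym (advance-zero d p)
endpoint-replicate p (suc k) d =
  trans (endpoint-replicate (step d p) k d) (advance-advance d (+ 1) (+ k) p)

∈-walk-xrun : ∀ p {j k} → j ≤ℕ k → advance dx (+ j) p ∈ walk p (replicate k dx)
∈-walk-xrun p z≤n = here (advance-zero dx p)
∈-walk-xrun p {suc j} (s≤s j≤k) =
  there (subst (_∈ walk (step dx p) _) (advance-advance dx (+ 1) (+ j) p) (∈-walk-xrun (step dx p) j≤k))

gap : ℤ → ℤ → ℕ
gap a b = ∣ b - a ∣

+-gap : ∀ {a b} → a ≤ b → a + + gap a b ≡ b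
+-gap {a} {b} a≤b = begin
  a + + ∣ b - a ∣ ≡⟨ cong (λ k → a + k) (0≤i⇒+∣i∣≡i (i≤j⇒0≤j-i a≤b)) ⟩
  a + (b - a)     ≡⟨ +-comm a (b - a) ⟩
  (b - a) + a     ≡⟨ +-assoc b (- a) a ⟩
  b + (- a + a)   ≡⟨ cong (λ k → b + k) (+-inverseˡ a) ⟩
  b + + 0         ≡⟨ +-identityʳ b ⟩
  b               ∎
  where open ≡-Reasoning

gap-monoʳ : ∀ {a b c} → a ≤ b → b ≤ c → gap a b ≤ℕ gap a c
gap-monoʳ {a} {b} {c} a≤b b≤c with +-monoˡ-≤ (- a) b≤c
... | b-a≤c-a rewrite sym (0≤i⇒+∣i∣≡i (i≤j⇒0≤j-i a≤b))
                    | sym (0≤i⇒+∣i∣≡i (i≤j⇒0≤j-i (≤-trans a≤b b≤c))) with b-a≤c-a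
... | +≤+ le = le

goto : Point → Point → List Dir
goto p q = replicate (gap (px p) (px q)) dx
        ++ replicate (gap (py p) (py q)) dy
        ++ replicate (gap (pz p) (pz q)) dz

endpoint-goto : ∀ {p q} → p ≼ q → endpoint p (goto p q) ≡ q
endpoint-goto {p} {q} (x≤ , y≤ , z≤) = begin
  endpoint p (X ++ Y ++ Z)                       ≡⟨ endpoint-++ p X (Y ++ Z) ⟩
  endpoint (endpoint p X) (Y ++ Z)               ≡⟨ endpoint-++ (endpoint p X) Y Z ⟩
  endpoint (endpoint (endpoint p X) Y) Z
    ≡⟨ cong (λ r → endpoint (endpoint r Y) Z) (endpoint-replicate p kx dx) ⟩
  endpoint (endpoint p₁ Y) Z
    ≡⟨ cong (λ r → endpoint r Z) (endpoint-replicate p₁ ky dy) ⟩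
  endpoint p₂ Z                                  ≡⟨ endpoint-replicate p₂ kz dz ⟩
  advance dz (+ kz) p₂                           ≡⟨ pt-cong (+-gap x≤) (+-gap y≤) (+-gap z≤) ⟩
  q                                              ∎
  where
  open ≡-Reasoning
  kx = gap (px p) (px q)
  ky = gap (py p) (py q)
  kz = gap (pz p) (pz q)
  X = replicate kx dx
  Y = replicate ky dy
  Z = replicate kz dz
  p₁ = advance dx (+ kx) p
  p₂ = advance dy (+ ky) p₁

walk-goto-∈□ : ∀ {p q r B} → p ∈□ B → q ∈□ B → p ≼ q → r ∈ walk p (goto p q) → r ∈□ B
walk-goto-∈□ {p} {q} p∈ q∈ p≼q r∈ =
  let p≼r , r≼end = walk-between (goto p q) r∈
  in ∈□-convex p∈ q∈ p≼r (subst (_ ≼_) (endpoint-goto p≼q) r≼end)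

∈-walk-goto-xedge : ∀ {p a} q → px p ≤ a → a ≤ px q → pt a (py p) (pz p) ∈ walk p (goto p q)
∈-walk-goto-xedge {p} q p≤a a≤q =
  subst (_∈ walk p (goto p q)) (cong (λ b → pt b (py p) (pz p)) (+-gap p≤a))
        (∈-walk-++ˡ (replicate _ dx) _ (∈-walk-xrun p (gap-monoʳ p≤a a≤q)))

∈-walk-goto-++ʳ : ∀ {p q r} es → p ≼ q → r ∈ walk q es → r ∈ walk p (goto p q ++ es)
∈-walk-goto-++ʳ {p} {q} es p≼q r∈ =
  ∈-walk-++ʳ (goto p q) es (subst (λ o → _ ∈ walk o es) (sym (endpoint-goto p≼q)) r∈)

∈-walk-goto-++⁻ : ∀ {p q r} es → p ≼ q → r ∈ walk p (goto p q ++ es) →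
                  r ∈ walk p (goto p q) ⊎ r ∈ walk q es
∈-walk-goto-++⁻ {p} {q} es p≼q r∈ with ∈-walk-++⁻ (goto p q) es r∈
... | inj₁ r∈goto = inj₁ r∈goto
... | inj₂ r∈es  = inj₂ (subst (λ o → _ ∈ walk o es) (endpoint-goto p≼q) r∈es)

-- Staircases

record Consecutive (A B : Cuboid) : Set where
  field
    min≼min : minCorner A ≼ minCorner B
    min≼max : minCorner B ≼ maxCorner A
    max≼max : maxCorner A ≼ maxCorner B
open Consecutive

record WeaklyRegular (m : ℕ) (C : Fin (suc m) → Cuboid) : Set where
  field
    nonempty    : ∀ i → minCorner (C i) ≼ maxCorner (C i)
    consecutive : ∀ (i : Fin m) → Consecutive (C (inject₁ i)) (C (fsuc i))
open WeaklyRegular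

tail : ∀ {m C} → WeaklyRegular (suc m) C → WeaklyRegular m (C ∘ fsuc)
tail wr = record { nonempty = nonempty wr ∘ fsuc ; consecutive = consecutive wr ∘ fsuc }

staircase-fsuc : ∀ {m C p} → Staircase m (C ∘ fsuc) p → Staircase (suc m) C p
staircase-fsuc (i , p∈) = fsuc i , p∈

regular⇒weaklyRegular : ∀ {m C} → Regular m C → WeaklyRegular m C
regular⇒weaklyRegular (twoPoints , _ , consec) = record
  { nonempty    = λ i → let _ , _ , p∈ , _ = twoPoints i ; min≼p , p≼max = ∈C⇒∈□ p∈
                        in ≼-trans min≼p p≼max
  ; consecutive = λ i → let (min≼min , _) , min≼max , (max≼max , _) = consec i
                        in record { min≼min = min≼min ; min≼max = min≼max ; max≼max = max≼max }
  }

regular⇒minCorner≡origin : ∀ {m C} → Regular m C → minCorner (C fzero) ≡ origin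
regular⇒minCorner≡origin (_ , (x≡0 , y≡0 , z≡0) , _) = pt-cong x≡0 y≡0 z≡0

minCorner-least : ∀ {m C p} → WeaklyRegular m C → Staircase m C p → minCorner (C fzero) ≼ p
minCorner-least wr (fzero , p∈) = proj₁ (∈C⇒∈□ p∈)
minCorner-least {suc m} wr (fsuc i , p∈) =
  ≼-trans (min≼min (consecutive wr fzero)) (minCorner-least (tail wr) (i , p∈))

staircase-∪-closedˡ : ∀ {m C x q} → WeaklyRegular m C → x ≼ maxCorner (C fzero) →
                      Staircase m C q → Staircase m C (x ∪ q)
staircase-∪-closedˡ {x = x} {q} wr x≼max (fzero , q∈) =
  let min≼q , q≼max = ∈C⇒∈□ q∈
  in fzero , ∈□⇒∈C (≼-trans min≼q (∪-upperʳ x q) , ∪-lub x≼max q≼max)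
staircase-∪-closedˡ {suc m} wr x≼max (fsuc i , q∈) =
  staircase-fsuc (staircase-∪-closedˡ (tail wr) (≼-trans x≼max (max≼max (consecutive wr fzero))) (i , q∈))

staircase-∪-closed : ∀ {m C p q} → WeaklyRegular m C →
                     Staircase m C p → Staircase m C q → Staircase m C (p ∪ q)
staircase-∪-closed wr (fzero , p∈) q∈S = staircase-∪-closedˡ wr (proj₂ (∈C⇒∈□ p∈)) q∈S
staircase-∪-closed {suc m} {C} {p} {q} wr (fsuc i , p∈) (fzero , q∈) =
  subst (Staircase (suc m) C) (∪-comm q p)
        (staircase-∪-closedˡ wr (proj₂ (∈C⇒∈□ q∈)) (fsuc i , p∈))
staircase-∪-closed {suc m} wr (fsuc i , p∈) (fsuc j , q∈) =
  staircase-fsuc (staircase-∪-closed (tail wr) (i , p∈) (j , q∈))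

-- The chain along the bottom x-edges

edge : Cuboid → ℤ → Point
edge B a = pt a (ymin B) (zmin B)

edge≼maxCorner : ∀ {B a} → minCorner B ≼ maxCorner B → a ≤ xmax B → edge B a ≼ maxCorner B
edge≼maxCorner (_ , y≤ , z≤) hi = hi , y≤ , z≤

edge-∈□ : ∀ {B a} → minCorner B ≼ maxCorner B → xmin B ≤ a → a ≤ xmax B → edge B a ∈□ B
edge-∈□ nonempty lo hi = (lo , ≤-refl , ≤-refl) , edge≼maxCorner nonempty hi

edge-below : ∀ B {p} → minCorner B ≼ p → edge B (px p) ≼ p
edge-below B (_ , y≤ , z≤) = ≤-refl , y≤ , z≤

next-edge-∈□ : ∀ {A B} → minCorner A ≼ maxCorner A → Consecutive A B → edge B (xmax A) ∈□ A
next-edge-∈□ (x≤ , _) c =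
  let _ , y≤ , z≤ = min≼min c ; _ , y≤′ , z≤′ = min≼max c
  in (x≤ , y≤ , z≤) , (≤-refl , y≤′ , z≤′)

edge≼next-edge : ∀ {A B a} → Consecutive A B → a ≤ xmax A → edge A a ≼ edge B (xmax A)
edge≼next-edge c a≤ = let _ , y≤ , z≤ = min≼min c in a≤ , y≤ , z≤

xPath : (m : ℕ) → (Fin (suc m) → Cuboid) → ℤ → List Dir
xPath zero    C a = goto (edge (C fzero) a) (maxCorner (C fzero))
xPath (suc m) C a = goto (edge (C fzero) a) (edge (C (fsuc fzero)) (xmax (C fzero)))
                 ++ xPath m (C ∘ fsuc) (xmax (C fzero))

xWalk : (m : ℕ) → (Fin (suc m) → Cuboid) → ℤ → List Point
xWalk m C a = walk (edge (C fzero) a) (xPath m C a)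

xWalk-⊆ : ∀ {m C a q} → WeaklyRegular m C → xmin (C fzero) ≤ a → a ≤ xmax (C fzero) →
          q ∈ xWalk m C a → Staircase m C q
xWalk-⊆ {zero} wr lo hi q∈ =
  let e∈ = edge-∈□ (nonempty wr fzero) lo hi
  in fzero , ∈□⇒∈C (walk-goto-∈□ e∈ (maxCorner-∈□ (nonempty wr fzero)) (proj₂ e∈) q∈)
xWalk-⊆ {suc m} {C} wr lo hi q∈
  with ∈-walk-goto-++⁻ (xPath m (C ∘ fsuc) _) (edge≼next-edge (consecutive wr fzero) hi) q∈
... | inj₁ q∈goto =
  fzero , ∈□⇒∈C (walk-goto-∈□ (edge-∈□ (nonempty wr fzero) lo hi)
                              (next-edge-∈□ (nonempty wr fzero) (consecutive wr fzero))
                              (edge≼next-edge (consecutive wr fzero) hi) q∈goto)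
... | inj₂ q∈rest =
  let c = consecutive wr fzero
  in staircase-fsuc (xWalk-⊆ (tail wr) (proj₁ (min≼max c)) (proj₁ (max≼max c)) q∈rest)

xWalk-upper : ∀ {m C a p} → WeaklyRegular m C → a ≤ xmax (C fzero) →
              Staircase m C p → p ≼ endpoint (edge (C fzero) a) (xPath m C a)
xWalk-upper {zero} wr hi (fzero , p∈) =
  subst (_ ≼_) (sym (endpoint-goto (edge≼maxCorner (nonempty wr fzero) hi))) (proj₂ (∈C⇒∈□ p∈))
xWalk-upper {suc m} {C} {a} {p} wr hi p∈S = subst (p ≼_) (sym endpoint≡) (bound p∈S)
  where
  c = consecutive wr fzero
  e′ = edge (C (fsuc fzero)) (xmax (C fzero))
  rest = xPath m (C ∘ fsuc) (xmax (C fzero))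
  endpoint≡ : endpoint (edge (C fzero) a) (xPath (suc m) C a) ≡ endpoint e′ rest
  endpoint≡ = trans (endpoint-++ _ (goto _ e′) rest)
                    (cong (λ o → endpoint o rest) (endpoint-goto (edge≼next-edge c hi)))
  bound : Staircase (suc m) C p → p ≼ endpoint e′ rest
  bound (fzero , p∈) =
    ≼-trans (proj₂ (∈C⇒∈□ p∈))
      (≼-trans (max≼max c) (xWalk-upper (tail wr) (proj₁ (max≼max c))
                             (fzero , ∈□⇒∈C (maxCorner-∈□ (nonempty wr (fsuc fzero))))))
  bound (fsuc i , p∈) = xWalk-upper (tail wr) (proj₁ (max≼max c)) (i , p∈)

xWalk-covers : ∀ {m C a p} → WeaklyRegular m C → a ≤ xmax (C fzero) → Staircase m C p → a ≤ px p →
               Σ Point λ q → q ∈ xWalk m C a × q ≼ p × px p ≤ px q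
xWalk-covers {zero} {C} {p = p} wr hi p∈S@(fzero , p∈) a≤p =
  edge (C fzero) (px p) , ∈-walk-goto-xedge (maxCorner (C fzero)) a≤p (proj₁ (proj₂ (∈C⇒∈□ p∈))) ,
  edge-below (C fzero) (minCorner-least wr p∈S) , ≤-refl
xWalk-covers {suc m} {C} {a} {p} wr hi p∈S a≤p with px p ≤? xmax (C fzero)
... | yes p≤max =
  edge (C fzero) (px p) , ∈-walk-++ˡ (goto e e′) rest (∈-walk-goto-xedge e′ a≤p p≤max) ,
  edge-below (C fzero) (minCorner-least wr p∈S) , ≤-refl
  where
  e = edge (C fzero) a
  e′ = edge (C (fsuc fzero)) (xmax (C fzero))
  rest = xPath m (C ∘ fsuc) (xmax (C fzero))
... | no p≰max with p∈S
...   | fzero , p∈  = contradiction (proj₁ (proj₂ (∈C⇒∈□ p∈))) p≰max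
...   | fsuc i , p∈ =
  let c = consecutive wr fzero
      q , q∈ , q≼p , p≤q = xWalk-covers (tail wr) (proj₁ (max≼max c)) (i , p∈) (<⇒≤ (≰⇒> p≰max))
  in q , ∈-walk-goto-++ʳ _ (edge≼next-edge c hi) q∈ , q≼p , p≤q

Covers : (Point → ℤ) → PSet → List Point → Set
Covers f S Γ = ∀ p → S p → Σ Point λ q → q ∈ Γ × q ≼ p × f p ≤ f q

CoveringChain : (Point → ℤ) → PSet → Set
CoveringChain f S = Σ (List Point) λ Γ → MaximalChain S Γ × Covers f S Γ

xChain : ∀ {m C} → WeaklyRegular m C → minCorner (C fzero) ≡ origin → CoveringChain px (Staircase m C)
xChain {m} {C} wr min≡origin =
  xWalk m C (xmin (C fzero)) ,
  walk-maximalChain _ _ (xWalk-⊆ wr ≤-refl hi) (λ _ → xWalk-upper wr hi) min≡origin ,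
  λ p p∈S → xWalk-covers wr hi p∈S (proj₁ (minCorner-least wr p∈S))
  where hi = proj₁ (nonempty wr fzero)

isChainTo-⊆ : ∀ {S : PSet} Γ {X q} → IsChainTo S Γ X → q ∈ Γ → S q
isChainTo-⊆ (p ∷ [])    (p∈S , _)       (here refl) = p∈S
isChainTo-⊆ (p ∷ q ∷ Γ) (p∈S , _)       (here refl) = p∈S
isChainTo-⊆ (p ∷ q ∷ Γ) (_ , _ , chain) (there r∈) = isChainTo-⊆ (q ∷ Γ) chain r∈

maximalChain-⊆ : ∀ {S : PSet} {Γ q} → MaximalChain S Γ → q ∈ Γ → S q
maximalChain-⊆ {Γ = Γ} (_ , _ , _ , chain) = isChainTo-⊆ Γ chain

coveringChains⇒convexDim≤3 : ∀ {S : PSet} → (∀ {p q} → S p → S q → S (p ∪ q)) →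
  CoveringChain px S → CoveringChain py S → CoveringChain pz S → ConvexDimAtMost S 3
coveringChains⇒convexDim≤3 {S} ∪-closed
  (Γx , chainx , coversx) (Γy , chainy , coversy) (Γz , chainz , coversz) =
  2 , s≤s (s≤s (s≤s z≤n)) , Γ , chain , λ p → mk⇔ (decompose p) compose
  where
  Γ : Vector (List Point) 3
  Γ = Γx ∷ᵛ Γy ∷ᵛ Γz ∷ᵛ []ᵛ
  chain : ∀ j → MaximalChain S (Γ j)
  chain fzero               = chainx
  chain (fsuc fzero)        = chainy
  chain (fsuc (fsuc fzero)) = chainz
  decompose : ∀ p → S p → Σ (Vector Point 3) λ A → (∀ j → A j ∈ Γ j) × p ≡ bigUnion 2 A
  decompose p p∈S with coversx p p∈S | coversy p p∈S | coversz p p∈S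
  ... | qx , qx∈ , qx≼p , x≤ | qy , qy∈ , qy≼p , y≤ | qz , qz∈ , qz≼p , z≤ =
    qx ∷ᵛ qy ∷ᵛ qz ∷ᵛ []ᵛ ,
    (λ { fzero → qx∈ ; (fsuc fzero) → qy∈ ; (fsuc (fsuc fzero)) → qz∈ }) ,
    join-of-witnesses qx≼p qy≼p qz≼p x≤ y≤ z≤
  compose : ∀ {p} → Σ (Vector Point 3) (λ A → (∀ j → A j ∈ Γ j) × p ≡ bigUnion 2 A) → S p
  compose (A , A∈ , refl) =
    ∪-closed (maximalChain-⊆ (chain fzero) (A∈ fzero))
             (∪-closed (maximalChain-⊆ (chain (fsuc fzero)) (A∈ (fsuc fzero)))
                       (maximalChain-⊆ (chain (fsuc (fsuc fzero))) (A∈ (fsuc (fsuc fzero)))))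

-- Cyclic permutation of the coordinates

rotate unrotate : Point → Point
rotate   p = pt (py p) (pz p) (px p)
unrotate p = pt (pz p) (px p) (py p)

rotateᶜ : Cuboid → Cuboid
rotateᶜ B = cuboid (ymin B) (ymax B) (zmin B) (zmax B) (xmin B) (xmax B)

rotate-≼ : ∀ {p q} → p ≼ q → rotate p ≼ rotate q
rotate-≼ (x≤ , y≤ , z≤) = y≤ , z≤ , x≤

unrotate-≼ : ∀ {p q} → p ≼ q → unrotate p ≼ unrotate q
unrotate-≼ (x≤ , y≤ , z≤) = z≤ , x≤ , y≤

unitStep-unrotate : ∀ {p q} → UnitStep p q → UnitStep (unrotate p) (unrotate q)
unitStep-unrotate (inj₁ refl)        = inj₂ (inj₁ refl)
unitStep-unrotate (inj₂ (inj₁ refl)) = inj₂ (inj₂ refl)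
unitStep-unrotate (inj₂ (inj₂ refl)) = inj₁ refl

weaklyRegular-rotate : ∀ {m C} → WeaklyRegular m C → WeaklyRegular m (rotateᶜ ∘ C)
weaklyRegular-rotate wr = record
  { nonempty    = rotate-≼ ∘ nonempty wr
  ; consecutive = λ i → let c = consecutive wr i in record
      { min≼min = rotate-≼ (min≼min c)
      ; min≼max = rotate-≼ (min≼max c)
      ; max≼max = rotate-≼ (max≼max c) }
  }

staircase-rotate : ∀ {m C} p → Staircase m C p ⇔ Staircase m (rotateᶜ ∘ C) (rotate p)
staircase-rotate p = mk⇔ (λ (i , (x∈ , y∈ , z∈)) → i , (y∈ , z∈ , x∈))
                         (λ (i , (y∈ , z∈ , x∈)) → i , (x∈ , y∈ , z∈))

-- rotate and unrotate are mutually inverse up to the η-law of Point.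
module _ {S S′ : PSet} (S⇔S′ : ∀ p → S p ⇔ S′ (rotate p)) where

  private
    unrotate-∈ : ∀ {q} → S′ q → S (unrotate q)
    unrotate-∈ {q} = Equivalence.from (S⇔S′ (unrotate q))

  isChainTo-unrotate : ∀ Γ {X} → IsChainTo S′ Γ X → IsChainTo S (map unrotate Γ) (unrotate X)
  isChainTo-unrotate (p ∷ [])    (p∈ , refl)        = unrotate-∈ p∈ , refl
  isChainTo-unrotate (p ∷ q ∷ Γ) (p∈ , unit , chain) =
    unrotate-∈ p∈ , unitStep-unrotate unit , isChainTo-unrotate (q ∷ Γ) chain

  coveringChain-unrotate : ∀ {f} → CoveringChain f S′ → CoveringChain (f ∘ rotate) S
  coveringChain-unrotate (Γ , (X , (X∈ , upper) , (rest , Γ≡) , chain) , covers) =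
    map unrotate Γ ,
    (unrotate X ,
     (unrotate-∈ X∈ , λ p p∈ → unrotate-≼ (upper (rotate p) (Equivalence.to (S⇔S′ p) p∈))) ,
     (map unrotate rest , cong (map unrotate) Γ≡) ,
     isChainTo-unrotate Γ chain) ,
    λ p p∈ → let q , q∈ , q≼ , le = covers (rotate p) (Equivalence.to (S⇔S′ p) p∈)
             in unrotate q , ∈-map⁺ unrotate q∈ , unrotate-≼ q≼ , le

corollary2 : (m : ℕ) (C : Fin (suc m) → Cuboid) → Regular m C →
    ConvexDimAtMost (Staircase m C) 3
corollary2 m C reg =
  coveringChains⇒convexDim≤3 (staircase-∪-closed wr)
    (xChain wr min≡origin)
    (coveringChain-unrotate staircase-rotate (xChain wr′ (cong rotate min≡origin)))
    (coveringChain-unrotate staircase-rotate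
      (coveringChain-unrotate staircase-rotate (xChain wr″ (cong (rotate ∘ rotate) min≡origin))))
  where
  wr = regular⇒weaklyRegular reg
  wr′ = weaklyRegular-rotate wr
  wr″ = weaklyRegular-rotate wr′
  min≡origin = regular⇒minCorner≡origin reg
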